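{- Let $n\ge 2$ be even and $1\le\Delta\le\lfloor\log_2 n\rfloor$, and consider the Kn\"odel graph $W_{\Delta,n}$ with partite sets $U=\{u_1,\dots,u_{n/2}\}$ and $V=\{v_1,\dots,v_{n/2}\}$. For any two distinct vertices $u_i,u_j\in U$, we have $N(u_i)\cap N(u_j)\neq\emptyset$ if and only if $id(u_i,u_j)\in\mathscr{M}_\Delta$ or $\frac{n}{2}-id(u_i,u_j)\in\mathscr{M}_\Delta$.
   Context: The Kn\"odel graph $W_{\Delta,n}$ (for even $n\ge2$, $1\le\Delta\le\lfloor\log_2 n\rfloor$) is the bipartite graph with partite sets $U=\{u_1,\dots,u_{n/2}\}$ and $V=\{v_1,\dots,v_{n/2}\}$ in which $u_i$ and $v_j$ are adjacent if and only if $j\equiv i+2^k-1 \pmod{n/2}$ for some $k\in\{0,1,\dots,\Delta-1\}$ (indices taken in $\{1,\dots,n/2\}$). $N(x)$ denotes the open neighborhood of a vertex $x$. For $u_i,u_j\in U$ the index-distance is $id(u_i,u_j)=\min\{|i-j|,\ \frac{n}{2}-|i-j|\}$. The set $\mathscr{M}_\Delta$ is $\{2^a-2^b: 0\le b<a<\Delta\}$ (integers $a,b$). -}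

module Defs where

open import Data.Nat using (ℕ; _+_; _*_; _∸_; _^_; _≤_; _<_; ∣_-_∣; _⊓_; _/_)
open import Data.Product using (∃; ∃-syntax; _×_)
open import Data.Sum using (_⊎_)
open import Relation.Binary.PropositionalEquality using (_≡_)

ModEq : ℕ → ℕ → ℕ → Set
ModEq m a b = ∃[ q ] (a ≡ b + q * m ⊎ b ≡ a + q * m)

half : ℕ → ℕ
half n = n / 2

-- Vertices u_i, v_j are represented by their indices; U-indices are
-- the first argument, V-indices the second.
KnAdj : (Δ n i j : ℕ) → Set
KnAdj Δ n i j = ∃[ k ] (k < Δ × ModEq (half n) j (i + 2 ^ k ∸ 1))

ValidIdx : ℕ → ℕ → Set
ValidIdx n i = 1 ≤ i × i ≤ half n

CommonNbr : (Δ n i j : ℕ) → Set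
CommonNbr Δ n i j = ∃[ l ] (ValidIdx n l × KnAdj Δ n i l × KnAdj Δ n j l)

idist : (n i j : ℕ) → ℕ
idist n i j = ∣ i - j ∣ ⊓ (half n ∸ ∣ i - j ∣)

InM : ℕ → ℕ → Set
InM Δ x = ∃[ a ] ∃[ b ] (b < a × a < Δ × x ≡ 2 ^ a ∸ 2 ^ b)

module Submission where

-- Write m = n/2.  Indices are shifted by one, u_{p+1} ~ v_l  iff
-- l ≡ p + 2^a (mod m) for some a < Δ.  Hence u_{p+1} and u_{p+1+d} have a
-- common neighbour iff 2^a ≡ d + 2^b (mod m) for some a, b < Δ (a "power
-- gap" of size d).  Because Δ ≤ ⌊log₂ n⌋ every 2^a with a < Δ is at most m,
-- so for 0 < d < m such a congruence is one of two exact equations: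
-- d = 2^a − 2^b (when b < a), or d + (2^b − 2^a) = m (when a < b);
-- a = b is impossible.  These are d ∈ 𝓜_Δ and m − d ∈ 𝓜_Δ respectively.
-- Finally id(u_i,u_j) is d or m − d, and the condition is symmetric
-- under d ↦ m − d.

open import Defs
open import Data.Nat using (ℕ; zero; suc; _+_; _*_; _∸_; _^_; _≤_; _<_; _⊓_; _/_; _%_; z≤n; s≤s; NonZero; >-nonZero; >-nonZero⁻¹; ⌊_/2⌋; ⌈_/2⌉)
open import Data.Nat.Properties
open import Data.Nat.DivMod using (m≡m%n+[m/n]*n; [m+kn]%n≡m%n; n%n≡0; m%n<n; m<n⇒m%n≡m; m*n/n≡m; /-monoˡ-≤)
open import Data.Nat.Divisibility using (_∣_)
open import Data.Nat.Logarithm using (⌊log₂_⌋; ⌊log₂⌊n/2⌋⌋≡⌊log₂n⌋∸1)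
open import Data.Product using (∃; _×_; _,_)
open import Data.Sum using (_⊎_; inj₁; inj₂; swap)
open import Data.Empty using (⊥-elim)
open import Relation.Binary using (tri<; tri≈; tri>)
open import Relation.Binary.PropositionalEquality using (_≡_; _≢_; refl; sym; trans; cong; cong₂; subst; subst₂; module ≡-Reasoning)
open import Function.Bundles using (_⇔_; mk⇔; Equivalence)
open import Function.Properties.Equivalence using () renaming (sym to ⇔-sym; trans to ⇔-trans)

module Congruence (m : ℕ) .{{_ : NonZero m}} where

  -- ModEq agrees with equality of remainders; this gives symmetry and
  -- transitivity for free.
  modEq⇒%≡ : ∀ {a b} → ModEq m a b → a % m ≡ b % m
  modEq⇒%≡ {a} {b} (q , inj₁ a≡b+qm) = trans (cong (_% m) a≡b+qm) ([m+kn]%n≡m%n b q m)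
  modEq⇒%≡ {a} {b} (q , inj₂ b≡a+qm) = sym (trans (cong (_% m) b≡a+qm) ([m+kn]%n≡m%n a q m))

  same-remainder : ∀ {x y} → y % m ≡ x % m → x / m ≤ y / m → y ≡ x + (y / m ∸ x / m) * m
  same-remainder {x} {y} same x/≤y/ = begin
    y                                         ≡⟨ m≡m%n+[m/n]*n y m ⟩
    y % m + y / m * m                         ≡⟨ cong₂ (λ r k → r + k * m) same (sym (m+[n∸m]≡n x/≤y/)) ⟩
    x % m + (x / m + (y / m ∸ x / m)) * m     ≡⟨ cong (x % m +_) (*-distribʳ-+ m (x / m) _) ⟩
    x % m + (x / m * m + (y / m ∸ x / m) * m) ≡⟨ sym (+-assoc (x % m) _ _) ⟩
    x % m + x / m * m + (y / m ∸ x / m) * m   ≡⟨ cong (_+ (y / m ∸ x / m) * m) (sym (m≡m%n+[m/n]*n x m)) ⟩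
    x + (y / m ∸ x / m) * m                   ∎
    where open ≡-Reasoning

  %≡⇒modEq : ∀ {a b} → a % m ≡ b % m → ModEq m a b
  %≡⇒modEq {a} {b} a%≡b% with ≤-total (a / m) (b / m)
  ... | inj₁ a/≤b/ = (b / m ∸ a / m) , inj₂ (same-remainder (sym a%≡b%) a/≤b/)
  ... | inj₂ b/≤a/ = (a / m ∸ b / m) , inj₁ (same-remainder a%≡b% b/≤a/)

  modEq-sym : ∀ {a b} → ModEq m a b → ModEq m b a
  modEq-sym a≡b = %≡⇒modEq (sym (modEq⇒%≡ a≡b))

  modEq-trans : ∀ {a b c} → ModEq m a b → ModEq m b c → ModEq m a c
  modEq-trans a≡b b≡c = %≡⇒modEq (trans (modEq⇒%≡ a≡b) (modEq⇒%≡ b≡c))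

  ≡⇒modEq : ∀ {a b} → a ≡ b → ModEq m a b
  ≡⇒modEq {b = b} a≡b = 0 , inj₁ (trans a≡b (sym (+-identityʳ b)))

  modEq-+ˡ : ∀ c {a b} → ModEq m a b → ModEq m (c + a) (c + b)
  modEq-+ˡ c {a} {b} (q , inj₁ e) = q , inj₁ (trans (cong (c +_) e) (sym (+-assoc c b (q * m))))
  modEq-+ˡ c {a} {b} (q , inj₂ e) = q , inj₂ (trans (cong (c +_) e) (sym (+-assoc c a (q * m))))

  modEq-cancelˡ : ∀ c {a b} → ModEq m (c + a) (c + b) → ModEq m a b
  modEq-cancelˡ c {a} {b} (q , inj₁ e) = q , inj₁ (+-cancelˡ-≡ c a (b + q * m) (trans e (+-assoc c b (q * m))))
  modEq-cancelˡ c {a} {b} (q , inj₂ e) = q , inj₂ (+-cancelˡ-≡ c b (a + q * m) (trans e (+-assoc c a (q * m))))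

  modEq-cancelʳ : ∀ c {a b} → ModEq m (a + c) (b + c) → ModEq m a b
  modEq-cancelʳ c {a} {b} e = modEq-cancelˡ c (subst₂ (ModEq m) (+-comm a c) (+-comm b c) e)

  residue-unique : ∀ {x y} → x < m → y < m → ModEq m x y → x ≡ y
  residue-unique x<m y<m x≡y = trans (sym (m<n⇒m%n≡m x<m)) (trans (modEq⇒%≡ x≡y) (m<n⇒m%n≡m y<m))

  multiple-below-2m : ∀ {s} → 0 < s → s < m + m → ModEq m 0 s → s ≡ m
  multiple-below-2m {suc s} _ _ (q , inj₁ ())
  multiple-below-2m {suc s} _ _ (zero , inj₂ ())
  multiple-below-2m {suc s} _ _ (suc zero , inj₂ s≡m) = trans s≡m (+-identityʳ m)
  multiple-below-2m {suc s} _ s<2m (suc (suc q) , inj₂ s≡[q+2]m) =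
    ⊥-elim (<⇒≱ s<2m (subst (m + m ≤_) (sym s≡[q+2]m) (+-monoʳ-≤ m (m≤m+n m (q * m)))))

  representative : ∀ t → ∃ λ l → (1 ≤ l × l ≤ m) × ModEq m l t
  representative t with t % m in t%≡r
  ... | zero  = m , (>-nonZero⁻¹ m , ≤-refl) , %≡⇒modEq (trans (n%n≡0 m) (sym t%≡r))
  ... | suc r = suc r , (s≤s z≤n , <⇒≤ r<m) , %≡⇒modEq (trans (m<n⇒m%n≡m r<m) (sym t%≡r))
    where
    r<m : suc r < m
    r<m = subst (_< m) t%≡r (m%n<n t m)

2^≤ : ∀ a n → 1 ≤ n → a ≤ ⌊log₂ n ⌋ → 2 ^ a ≤ n
2^≤ zero    n 1≤n _ = 1≤n
2^≤ (suc a) (suc zero) _ ()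
2^≤ (suc a) (suc (suc k)) _ a<log = begin
  2 * 2 ^ a               ≤⟨ *-monoʳ-≤ 2 (2^≤ a ⌊ n /2⌋ (s≤s z≤n) a≤log[n/2]) ⟩
  ⌊ n /2⌋ + (⌊ n /2⌋ + 0) ≤⟨ +-monoʳ-≤ ⌊ n /2⌋ (≤-trans (≤-reflexive (+-identityʳ _)) (⌊n/2⌋≤⌈n/2⌉ n)) ⟩
  ⌊ n /2⌋ + ⌈ n /2⌉       ≡⟨ ⌊n/2⌋+⌈n/2⌉≡n n ⟩
  n                       ∎
  where
  open ≤-Reasoning
  n = suc (suc k)
  a≤log[n/2] : a ≤ ⌊log₂ ⌊ n /2⌋ ⌋
  a≤log[n/2] = subst (a ≤_) (sym (⌊log₂⌊n/2⌋⌋≡⌊log₂n⌋∸1 n)) (∸-monoˡ-≤ 1 a<log)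

2^≤half : ∀ n Δ → 2 ≤ n → Δ ≤ ⌊log₂ n ⌋ → ∀ a → a < Δ → 2 ^ a ≤ half n
2^≤half n Δ 2≤n Δ≤log a a<Δ = begin
  2 ^ a             ≡⟨ sym (m*n/n≡m (2 ^ a) 2) ⟩
  2 ^ a * 2 / 2     ≤⟨ /-monoˡ-≤ 2 (subst (_≤ n) (*-comm 2 (2 ^ a)) 2^[a+1]≤n) ⟩
  n / 2             ∎
  where
  open ≤-Reasoning
  2^[a+1]≤n : 2 ^ suc a ≤ n
  2^[a+1]≤n = 2^≤ (suc a) n (≤-trans (s≤s z≤n) 2≤n) (≤-trans a<Δ Δ≤log)

PowerGap : (Δ m d : ℕ) → Set
PowerGap Δ m d = ∃ λ a → ∃ λ b → a < Δ × b < Δ × ModEq m (2 ^ a) (d + 2 ^ b)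

2^-gap : ∀ {a b} → b < a → (2 ^ a ∸ 2 ^ b) + 2 ^ b ≡ 2 ^ a
2^-gap b<a = m∸n+n≡m (^-monoʳ-≤ 2 (<⇒≤ b<a))

module PowerGaps (m Δ : ℕ) .{{_ : NonZero m}} (bounded : ∀ a → a < Δ → 2 ^ a ≤ m) where
  open Congruence m

  2^-gap<m : ∀ {a b} → b < a → a < Δ → 2 ^ a ∸ 2 ^ b < m
  2^-gap<m {a} {b} b<a a<Δ = begin-strict
    2 ^ a ∸ 2 ^ b             <⟨ m<m+n (2 ^ a ∸ 2 ^ b) (m^n>0 2 b) ⟩
    (2 ^ a ∸ 2 ^ b) + 2 ^ b   ≡⟨ 2^-gap b<a ⟩
    2 ^ a                     ≤⟨ bounded a a<Δ ⟩
    m                         ∎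
    where open ≤-Reasoning

  -- Equal exponents would force d ≡ 0; otherwise the congruence is an
  -- equation between numbers below m (b < a) or below 2m (a < b).
  gap⇒InM : ∀ {d} → 0 < d → d < m → PowerGap Δ m d → InM Δ d ⊎ InM Δ (m ∸ d)
  gap⇒InM {d} 0<d d<m (a , b , a<Δ , b<Δ , gap) with <-cmp a b
  ... | tri≈ _ refl _ =
    ⊥-elim (<⇒≢ 0<d (residue-unique (<-trans 0<d d<m) d<m (modEq-cancelʳ (2 ^ a) gap)))
  ... | tri> _ _ b<a = inj₁ (a , b , b<a , a<Δ , sym (residue-unique (2^-gap<m b<a a<Δ) d<m x≡d))
    where
    x≡d : ModEq m (2 ^ a ∸ 2 ^ b) d
    x≡d = modEq-cancelʳ (2 ^ b) (subst (λ z → ModEq m z (d + 2 ^ b)) (sym (2^-gap b<a)) gap)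
  ... | tri< a<b _ _ = inj₂ (b , a , a<b , b<Δ , m∸d≡y)
    where
    y = 2 ^ b ∸ 2 ^ a
    regroup : d + 2 ^ b ≡ (d + y) + 2 ^ a
    regroup = trans (cong (d +_) (sym (2^-gap a<b))) (sym (+-assoc d y (2 ^ a)))
    d+y≡m : d + y ≡ m
    d+y≡m = multiple-below-2m (<-≤-trans 0<d (m≤m+n d y)) (+-mono-< d<m (2^-gap<m a<b b<Δ))
              (modEq-cancelʳ (2 ^ a) (subst (ModEq m (2 ^ a)) regroup gap))
    m∸d≡y : m ∸ d ≡ y
    m∸d≡y = trans (cong (_∸ d) (sym d+y≡m)) (m+n∸m≡n d y)

  -- Conversely d = 2^a − 2^b gives 2^a = d + 2^b, and m − d = 2^a − 2^b
  -- gives d + 2^a = 2^b + m.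
  InM⇒gap : ∀ {d} → d ≤ m → InM Δ d ⊎ InM Δ (m ∸ d) → PowerGap Δ m d
  InM⇒gap {d} _ (inj₁ (a , b , b<a , a<Δ , d≡x)) =
    a , b , a<Δ , <-trans b<a a<Δ , ≡⇒modEq (sym (trans (cong (_+ 2 ^ b) d≡x) (2^-gap b<a)))
  InM⇒gap {d} d≤m (inj₂ (a , b , b<a , a<Δ , m∸d≡x)) =
    b , a , <-trans b<a a<Δ , a<Δ , (1 , inj₂ d+2^a≡2^b+m)
    where
    open ≡-Reasoning
    d+2^a≡2^b+m : d + 2 ^ a ≡ 2 ^ b + 1 * m
    d+2^a≡2^b+m = begin
      d + 2 ^ a                 ≡⟨ cong (d +_) (sym (trans (cong (_+ 2 ^ b) m∸d≡x) (2^-gap b<a))) ⟩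
      d + ((m ∸ d) + 2 ^ b)     ≡⟨ sym (+-assoc d (m ∸ d) (2 ^ b)) ⟩
      (d + (m ∸ d)) + 2 ^ b     ≡⟨ cong (_+ 2 ^ b) (m+[n∸m]≡n d≤m) ⟩
      m + 2 ^ b                 ≡⟨ +-comm m (2 ^ b) ⟩
      2 ^ b + m                 ≡⟨ cong (2 ^ b +_) (sym (*-identityˡ m)) ⟩
      2 ^ b + 1 * m             ∎

  gap⇔InM : ∀ d → 0 < d → d < m → PowerGap Δ m d ⇔ (InM Δ d ⊎ InM Δ (m ∸ d))
  gap⇔InM d 0<d d<m = mk⇔ (gap⇒InM 0<d d<m) (InM⇒gap (<⇒≤ d<m))

-- The index distance of a pair at offset d is d ⊓ (m − d); any condition
-- that is symmetric under d ↦ m − d may be tested on d itself.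
folded-distance : ∀ (P : ℕ → Set) {m d} → d ≤ m →
  (P (d ⊓ (m ∸ d)) ⊎ P (m ∸ (d ⊓ (m ∸ d)))) ⇔ (P d ⊎ P (m ∸ d))
folded-distance P {m} {d} d≤m with ≤-total d (m ∸ d)
... | inj₁ d≤m∸d rewrite m≤n⇒m⊓n≡m d≤m∸d = mk⇔ (λ h → h) (λ h → h)
... | inj₂ m∸d≤d rewrite m≥n⇒m⊓n≡n m∸d≤d | m∸[m∸n]≡n d≤m = mk⇔ swap swap

offset : ∀ {p q} → p < q → ∃ λ d → 0 < d × q ≡ p + d
offset {p} {q} p<q = q ∸ p , m<n⇒0<n∸m p<q , sym (m+[n∸m]≡n (<⇒≤ p<q))

Criterion : (Δ n i j : ℕ) → Set
Criterion Δ n i j = CommonNbr Δ n i j ⇔ (InM Δ (idist n i j) ⊎ InM Δ (half n ∸ idist n i j))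

module KnodelGraph (n Δ : ℕ) .{{_ : NonZero (half n)}} (bounded : ∀ a → a < Δ → 2 ^ a ≤ half n) where
  m : ℕ
  m = half n
  open Congruence m
  open PowerGaps m Δ bounded

  -- u_{p+1} ~ v_l  iff  l ≡ p + 2^a, so a common neighbour of u_{p+1} and
  -- u_{p+1+d} is the same as a power gap d (the neighbour is a
  -- representative of p + 2^a).
  commonNbr⇔gap : ∀ p d → CommonNbr Δ n (suc p) (suc (p + d)) ⇔ PowerGap Δ m d
  commonNbr⇔gap p d = mk⇔ to from
    where
    to : CommonNbr Δ n (suc p) (suc (p + d)) → PowerGap Δ m d
    to (l , _ , (a , a<Δ , l≡p+2^a) , (b , b<Δ , l≡p+d+2^b)) =
      a , b , a<Δ , b<Δ ,
      modEq-cancelˡ p (subst (ModEq m (p + 2 ^ a)) (+-assoc p d (2 ^ b))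
                             (modEq-trans (modEq-sym l≡p+2^a) l≡p+d+2^b))
    from : PowerGap Δ m d → CommonNbr Δ n (suc p) (suc (p + d))
    from (a , b , a<Δ , b<Δ , gap) with representative (p + 2 ^ a)
    ... | l , valid , l≡p+2^a =
      l , valid , (a , a<Δ , l≡p+2^a) ,
      (b , b<Δ , modEq-trans l≡p+2^a (subst (ModEq m (p + 2 ^ a)) (sym (+-assoc p d (2 ^ b))) (modEq-+ˡ p gap)))

  criterion-ordered : ∀ i j → ValidIdx n i → ValidIdx n j → i < j → Criterion Δ n i j
  criterion-ordered (suc p) (suc q) _ (_ , q<m) (s≤s p<q) with offset p<q
  ... | d , 0<d , refl rewrite ∣m-m+n∣≡n p d =
    ⇔-trans (commonNbr⇔gap p d)
      (⇔-trans (gap⇔InM d 0<d d<m) (⇔-sym (folded-distance (InM Δ) (<⇒≤ d<m))))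
    where
    d<m : d < m
    d<m = ≤-<-trans (m≤n+m d p) q<m

  criterion-sym : ∀ {i j} → Criterion Δ n j i → Criterion Δ n i j
  criterion-sym {i} {j} c rewrite ∣-∣-comm i j =
    mk⇔ (λ (l , v , i~l , j~l) → Equivalence.to c (l , v , j~l , i~l))
        (λ h → let (l , v , j~l , i~l) = Equivalence.from c h in l , v , i~l , j~l)

  criterion : ∀ i j → ValidIdx n i → ValidIdx n j → i ≢ j → Criterion Δ n i j
  criterion i j vi vj i≢j with <-cmp i j
  ... | tri< i<j _ _ = criterion-ordered i j vi vj i<j
  ... | tri≈ _ i≡j _ = ⊥-elim (i≢j i≡j)
  ... | tri> _ _ j<i = criterion-sym {i} {j} (criterion-ordered j i vj vi j<i)

lemma2p3 : (n Δ : ℕ) → 2 ∣ n → 2 ≤ n → 1 ≤ Δ → Δ ≤ ⌊log₂ n ⌋ →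
    (i j : ℕ) → ValidIdx n i → ValidIdx n j → i ≢ j →
    CommonNbr Δ n i j ⇔ (InM Δ (idist n i j) ⊎ InM Δ (half n ∸ idist n i j))
lemma2p3 n Δ _ 2≤n 1≤Δ Δ≤log = KnodelGraph.criterion n Δ {{half≢0}} bounded
  where
  bounded : ∀ a → a < Δ → 2 ^ a ≤ half n
  bounded = 2^≤half n Δ 2≤n Δ≤log
  -- half n ≥ 2^0 = 1, using Δ ≥ 1
  half≢0 : NonZero (half n)
  half≢0 = >-nonZero (bounded 0 1≤Δ)
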